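{- Let $G$ be a connected cograph. Then $\mu(G)>\mu_{\rm t}(G)$ if and only if $G$ is a big-$\mu$ graph $G=(K_1\cup K_t)+H$ having no universal vertex.
   Context: A cograph is a graph with no induced path on four vertices. A vertex is universal if it is adjacent to all other vertices. For graphs $A,B$ on disjoint vertex sets, $A\cup B$ is their disjoint union and $A+B$ their join. A big-$\mu$ graph is any graph of the form $(K_1\cup K_t)+H$ where $K_1$, $K_t$ (complete graph, $t\ge 0$, possibly empty) and $H$ (arbitrary graph) are on pairwise disjoint vertex sets. For a connected graph $G$ and $X\subseteq V(G)$, two vertices are $X$-visible if there is a shortest path between them whose internal vertices are not in $X$; $\mu(G)$ is the maximum size of a set $X$ such that every two vertices of $X$ are $X$-visible, and $\mu_{\rm t}(G)$ the maximum size of a set $X$ such that every two vertices of $V(G)$ are $X$-visible. -}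

module Defs where

open import Data.Nat using (ℕ; zero; suc; _≤_)
open import Data.Fin using (Fin)
open import Data.Fin.Subset using (Subset; _∈_; _∉_; ∣_∣)
open import Data.Bool using (Bool; true; false)
open import Data.List using (List; []; _∷_)
open import Data.List.Relation.Unary.All using (All)
open import Data.Product using (Σ; ∃; _×_; _,_)
open import Relation.Binary.PropositionalEquality using (_≡_; _≢_)
open import Relation.Nullary using (¬_)

record Graph (n : ℕ) : Set where
  field
    adj    : Fin n → Fin n → Bool
    sym    : ∀ u v → adj u v ≡ adj v u
    irrefl : ∀ u → adj u u ≡ false

open Graph public

module _ {n : ℕ} (G : Graph n) where

  Adj : Fin n → Fin n → Set
  Adj u v = adj G u v ≡ true

  data Walk : Fin n → Fin n → ℕ → Set where
    here : ∀ {u} → Walk u u 0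
    step : ∀ {u w v k} → Adj u w → Walk w v k → Walk u v (suc k)

  initVerts : ∀ {u v k} → Walk u v k → List (Fin n)
  initVerts here = []
  initVerts (step {u = u} _ p) = u ∷ initVerts p

  interior : ∀ {u v k} → Walk u v k → List (Fin n)
  interior here = []
  interior (step _ p) = initVerts p

  Connected : Set
  Connected = ∀ u v → ∃ λ k → Walk u v k

  -- a shortest u,v-path (a walk of minimum length is a path)
  IsShortest : ∀ {u v k} → Walk u v k → Set
  IsShortest {u} {v} {k} _ = ∀ k' → Walk u v k' → k ≤ k'

  Visible : Subset n → Fin n → Fin n → Set
  Visible X u v = Σ ℕ λ k → Σ (Walk u v k) λ p →
    IsShortest p × All (λ x → x ∉ X) (interior p)

  IsMutualVisibilitySet : Subset n → Set
  IsMutualVisibilitySet X = ∀ u v → u ∈ X → v ∈ X → Visible X u v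

  IsTotalMutualVisibilitySet : Subset n → Set
  IsTotalMutualVisibilitySet X = ∀ u v → Visible X u v

  IsMaxSize : (Subset n → Set) → ℕ → Set
  IsMaxSize P m = (Σ (Subset n) λ X → P X × ∣ X ∣ ≡ m)
                × (∀ X → P X → ∣ X ∣ ≤ m)

  IsMu : ℕ → Set
  IsMu = IsMaxSize IsMutualVisibilitySet

  IsMuT : ℕ → Set
  IsMuT = IsMaxSize IsTotalMutualVisibilitySet

  -- no induced path on four vertices a-b-c-d
  IsCograph : Set
  IsCograph = ∀ a b c d → a ≢ b → a ≢ c → a ≢ d → b ≢ c → b ≢ d → c ≢ d →
    Adj a b → Adj b c → Adj c d →
    ¬ (adj G a c ≡ false × adj G b d ≡ false × adj G a d ≡ false)

  IsUniversal : Fin n → Set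
  IsUniversal v = ∀ u → u ≢ v → Adj v u

  -- G = (K_1 ∪ K_t) + H : V(G) splits into {v}, a clique T (possibly empty)
  -- and the rest (the vertices of H), with v not adjacent to T, and every
  -- vertex of {v} ∪ T adjacent to every vertex of H.
  IsBigMu : Set
  IsBigMu = Σ (Fin n) λ v → Σ (Subset n) λ T →
      v ∉ T
    × (∀ a b → a ∈ T → b ∈ T → a ≢ b → Adj a b)
    × (∀ a → a ∈ T → ¬ Adj v a)
    × (∀ h → h ≢ v → h ∉ T → Adj v h × (∀ a → a ∈ T → Adj a h))

-- A connected cograph on at least two vertices is a join A + B (P4-freeness
-- lets every new vertex be placed so that G[L] stays a join or a disjoint
-- union).  Then V minus one vertex of A and one of B is a total
-- mutual-visibility set, so μ_t ≥ n - 2.  If μ > μ_t, a maximum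
-- mutual-visibility set X is not total, hence X = V - z; shortest paths
-- between non-adjacent vertices other than z must then pass through z,
-- which makes the non-neighbours of z a clique joined to the neighbours of
-- z: a big-μ graph, and a universal vertex u is excluded since V - u would
-- be total.  Conversely, in (K_1 ∪ K_t) + H the set V - v is mutually
-- visible, while without universal vertices a total set misses a neighbour
-- x of some vertex and a neighbour of x, so μ_t ≤ n - 2 < n - 1 ≤ μ.
module Submission where

open import Defs
open import Data.Nat using (ℕ; zero; suc; _+_; _≤_; _<_; z≤n; s≤s; s≤s⁻¹)
open import Data.Nat.Properties
  using (≤-trans; ≤-reflexive; <-irrefl; ≤-<-trans; <-≤-trans; m≤n+m; module ≤-Reasoning)
open import Data.Fin using (Fin; zero; suc; _≟_)
import Data.Fin.Properties as Fin
open import Data.Bool using (Bool; true; false)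
open import Data.Bool.Properties using (¬-not; not-¬) renaming (_≟_ to _≟ᵇ_)
open import Data.List using (List; []; _∷_; [_]; _++_; filter; allFin; tabulate)
open import Data.List.Relation.Unary.Any using (here; there)
open import Data.List.Relation.Unary.All using (all?; []; _∷_) renaming (lookup to All-lookup)
open import Data.List.Relation.Unary.All.Properties using (¬All⇒Any¬)
import Data.Vec as Vec
open import Data.Vec using (_∷_; here; there)
open import Data.Vec.Properties using (lookup∘tabulate; []=⇒lookup; lookup⇒[]=)
open import Data.Product using (∃; ∃₂; _×_; _,_; proj₁; proj₂)
open import Data.Sum using (_⊎_; inj₁; inj₂; [_,_]′; map₁)
open import Data.Empty using (⊥)
open import Function using (_∘_)
open import Function.Bundles using (_⇔_; mk⇔)
open import Relation.Binary.PropositionalEquality as ≡ using (_≡_; _≢_; refl; trans; cong; ≢-sym)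
open import Relation.Nullary using (¬_; yes; no; contradiction)
open import Relation.Nullary.Decidable using (¬?; _×-dec_; decidable-stable)
open import Relation.Unary using (Decidable)

module _ {n : ℕ} (G : Graph n) where

  adj-sym : ∀ {u v c} → adj G u v ≡ c → adj G v u ≡ c
  adj-sym {u} {v} = trans (Graph.sym G v u)

  Adj⇒≢ : ∀ {u v} → Adj G u v → u ≢ v
  Adj⇒≢ {u} uu refl = not-¬ uu (irrefl G u)

  Adj⇒≢-nonadjacent : ∀ {x y w} → Adj G x w → adj G y w ≡ false → x ≢ y
  Adj⇒≢-nonadjacent xw yw refl = not-¬ xw yw

  Bridges : Fin n → Fin n → Set
  Bridges a b = ∀ {u w} → u ≢ w → adj G u w ≡ false →
                ∃ λ x → (x ≡ a ⊎ x ≡ b) × Adj G u x × Adj G x w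

module _ {n : ℕ} (G : Graph n) where

  open import Data.List.Membership.Propositional using (_∈_; find)
  open import Data.List.Membership.Propositional.Properties
    using (∈-++⁺ˡ; ∈-++⁺ʳ; ∈-++⁻; ∈-filter⁺; ∈-filter⁻; ∈-allFin)

  allOrCounterexample : ∀ {P : Fin n → Set} → Decidable P → ∀ xs →
    (∀ {x} → x ∈ xs → P x) ⊎ ∃ λ x → x ∈ xs × ¬ P x
  allOrCounterexample P? xs with all? P? xs
  ... | yes all = inj₁ (All-lookup all)
  ... | no ¬all = inj₂ (find (¬All⇒Any¬ P? xs ¬all))

  -- G[L] as a join (kind true) or a disjoint union (kind false) of two
  -- non-empty parts; for kind false the parts may share vertices, which then
  -- have no neighbour in L.
  record Split (L : List (Fin n)) : Set where
    constructor split
    field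
      kind           : Bool
      left right     : List (Fin n)
      across         : ∀ {x y} → x ∈ left → y ∈ right → adj G x y ≡ kind
      left-nonempty  : ∃ (_∈ left)
      right-nonempty : ∃ (_∈ right)
      covers         : ∀ {x} → x ∈ L → x ∈ left ⊎ x ∈ right

  open Split using (kind; left; right)

  Split-[_] : ∀ v → Split [ v ]
  Split-[ v ] = split false [ v ] [ v ] across (v , here refl) (v , here refl) inj₁
    where
      across : ∀ {x y} → x ∈ [ v ] → y ∈ [ v ] → adj G x y ≡ false
      across (here refl) (here refl) = irrefl G v

  Split-swap : ∀ {L} → Split L → Split L
  Split-swap (split b P Q across sP sQ covers) =
    split b Q P (λ y∈Q x∈P → adj-sym G (across x∈P y∈Q)) sQ sP ([ inj₂ , inj₁ ]′ ∘ covers)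

  join-left : ∀ {L} v (σ : Split L) → (∀ {y} → y ∈ right σ → adj G v y ≡ kind σ) →
              Split (v ∷ L)
  join-left v (split b P Q across sP sQ covers) vQ =
    split b (v ∷ P) Q across′ (v , here refl) sQ covers′
    where
      across′ : ∀ {x y} → x ∈ v ∷ P → y ∈ Q → adj G x y ≡ b
      across′ (here refl) y∈Q = vQ y∈Q
      across′ (there x∈P) y∈Q = across x∈P y∈Q
      covers′ : ∀ {x} → x ∈ v ∷ _ → x ∈ v ∷ P ⊎ x ∈ Q
      covers′ (here refl) = inj₁ (here refl)
      covers′ (there x∈L) = map₁ there (covers x∈L)

  isolate : ∀ {L} v (σ : Split L) {c} → (∀ {y} → y ∈ left σ ++ right σ → adj G v y ≡ c) →
            Split (v ∷ L)
  isolate v (split _ P Q _ (p , p∈P) _ covers) {c} vPQ =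
    split c [ v ] (P ++ Q) across (v , here refl) (p , ∈-++⁺ˡ p∈P) covers′
    where
      across : ∀ {x y} → x ∈ [ v ] → y ∈ P ++ Q → adj G x y ≡ c
      across (here refl) = vPQ
      covers′ : ∀ {x} → x ∈ v ∷ _ → x ∈ [ v ] ⊎ x ∈ P ++ Q
      covers′ (here refl) = inj₁ (here refl)
      covers′ (there x∈L) = inj₂ ([ ∈-++⁺ˡ , ∈-++⁺ʳ P ]′ (covers x∈L))

  module _ (cograph : IsCograph G) where

    -- The edges of the path a-b-x-d are the pairs with adj ≢ c.  For c = true
    -- it is an induced P4 of the complement, and then b-d-a-x is one of G.
    no-induced-P4 : ∀ c {a b x d} → adj G a b ≢ c → adj G b x ≢ c → adj G x d ≢ c →
                  adj G a x ≡ c → adj G b d ≡ c → adj G a d ≡ c → ⊥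
    no-induced-P4 false ab bx xd ax bd ad =
      cograph _ _ _ _ a≢b a≢x a≢d b≢x b≢d x≢d (¬-not ab) (¬-not bx) (¬-not xd) (ax , bd , ad)
      where
        a≢b = ≢-sym (Adj⇒≢-nonadjacent G (¬-not bx) ax)
        a≢x = ≢-sym (Adj⇒≢-nonadjacent G (¬-not xd) ad)
        a≢d = ≢-sym (Adj⇒≢-nonadjacent G (adj-sym G (¬-not xd)) ax)
        b≢x = ≢-sym (Adj⇒≢-nonadjacent G (¬-not xd) bd)
        b≢d = Adj⇒≢-nonadjacent G (adj-sym G (¬-not ab)) (adj-sym G ad)
        x≢d = Adj⇒≢-nonadjacent G (adj-sym G (¬-not bx)) (adj-sym G bd)
    no-induced-P4 true ab bx xd ax bd ad =
      no-induced-P4 false (not-¬ bd) (not-¬ (adj-sym G ad)) (not-¬ ax)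
                        (¬-not (ab ∘ adj-sym G)) (¬-not (xd ∘ adj-sym G)) (¬-not bx)

    -- The new parts are {y | adj v y ≡ b} and v with the rest.  Two vertices
    -- x, y of one old part that v separates satisfy adj x y ≡ b: otherwise
    -- x-y-v-q would be an induced P4 of the graph "adj ≢ b", q being the
    -- vertex of the other old part with adj v q ≢ b.
    resplit : ∀ {L} v (σ : Split L) → let b = kind σ in
              (∃ λ p → p ∈ left σ × adj G v p ≢ b) → (∃ λ q → q ∈ right σ × adj G v q ≢ b) →
              (∃ λ u → u ∈ left σ ++ right σ × adj G v u ≡ b) → Split (v ∷ L)
    resplit v (split b P Q across _ _ covers) (p , p∈P , vp) (q , q∈Q , vq) (u , u∈PQ , vu) =
      split b (filter near? (P ++ Q)) (v ∷ filter far? (P ++ Q)) across′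
            (u , ∈-filter⁺ near? u∈PQ vu) (v , here refl) covers′
      where
        near? : Decidable (λ y → adj G v y ≡ b)
        near? y = adj G v y ≟ᵇ b
        far? : Decidable (λ y → adj G v y ≢ b)
        far? y = ¬? (near? y)

        across-old : ∀ {x y} → x ∈ P ++ Q → y ∈ P ++ Q → adj G v x ≡ b → adj G v y ≢ b →
                     adj G x y ≡ b
        across-old {x} {y} x∈ y∈ vx vy with ∈-++⁻ P x∈ | ∈-++⁻ P y∈
        ... | inj₁ x∈P | inj₂ y∈Q = across x∈P y∈Q
        ... | inj₂ x∈Q | inj₁ y∈P = adj-sym G (across y∈P x∈Q)
        ... | inj₁ x∈P | inj₁ y∈P = decidable-stable (adj G x y ≟ᵇ b) λ xy →
          no-induced-P4 b xy (vy ∘ adj-sym G) vq (adj-sym G vx) (across y∈P q∈Q) (across x∈P q∈Q)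
        ... | inj₂ x∈Q | inj₂ y∈Q = decidable-stable (adj G x y ≟ᵇ b) λ xy →
          no-induced-P4 b xy (vy ∘ adj-sym G) vp (adj-sym G vx)
                      (adj-sym G (across p∈P y∈Q)) (adj-sym G (across p∈P x∈Q))

        across′ : ∀ {x y} → x ∈ filter near? (P ++ Q) → y ∈ v ∷ filter far? (P ++ Q) →
                  adj G x y ≡ b
        across′ x∈ (here refl) = adj-sym G (proj₂ (∈-filter⁻ near? {xs = P ++ Q} x∈))
        across′ x∈ (there y∈) =
          let x∈PQ , vx = ∈-filter⁻ near? {xs = P ++ Q} x∈
              y∈PQ , vy = ∈-filter⁻ far? {xs = P ++ Q} y∈
          in across-old x∈PQ y∈PQ vx vy

        covers′ : ∀ {x} → x ∈ v ∷ _ →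
                  x ∈ filter near? (P ++ Q) ⊎ x ∈ v ∷ filter far? (P ++ Q)
        covers′ (here refl) = inj₂ (here refl)
        covers′ {x} (there x∈L) with [ ∈-++⁺ˡ , ∈-++⁺ʳ P ]′ (covers x∈L) | near? x
        ... | x∈PQ | yes vx = inj₁ (∈-filter⁺ near? x∈PQ vx)
        ... | x∈PQ | no vx  = inj₂ (there (∈-filter⁺ far? x∈PQ vx))

    Split-∷ : ∀ {L} v → Split L → Split (v ∷ L)
    Split-∷ v σ with allOrCounterexample (λ y → adj G v y ≟ᵇ kind σ) (right σ)
    ... | inj₁ vQ = join-left v σ vQ
    ... | inj₂ q with allOrCounterexample (λ y → adj G v y ≟ᵇ kind σ) (left σ)
    ...   | inj₁ vP = join-left v (Split-swap σ) vP
    ...   | inj₂ p with allOrCounterexample (λ y → ¬? (adj G v y ≟ᵇ kind σ)) (left σ ++ right σ)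
    ...     | inj₁ far = isolate v σ (¬-not ∘ far)
    ...     | inj₂ (u , u∈ , ¬far) =
                resplit v σ p q (u , u∈ , decidable-stable (adj G v u ≟ᵇ kind σ) ¬far)

    cograph-split : ∀ v L → Split (v ∷ L)
    cograph-split v []      = Split-[ v ]
    cograph-split v (w ∷ L) = Split-∷ v (cograph-split w L)

  module _ (σ : Split (allFin n)) where

    private
      covers-all : ∀ x → x ∈ left σ ⊎ x ∈ right σ
      covers-all x = Split.covers σ (∈-allFin x)

    walk-meets-both-parts : kind σ ≡ false → ∀ {x y k} → Walk G x y k →
                            x ∈ left σ → y ∈ right σ → ∃ λ w → w ∈ left σ × w ∈ right σ
    walk-meets-both-parts _ here x∈ y∈ = _ , x∈ , y∈
    walk-meets-both-parts b≡false (step {w = w} xw p) x∈ y∈ with covers-all w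
    ... | inj₁ w∈ = walk-meets-both-parts b≡false p w∈ y∈
    ... | inj₂ w∈ = contradiction (trans (Split.across σ x∈ w∈) b≡false) (not-¬ xw)

    connected⇒join⊎trivial : Connected G → kind σ ≡ true ⊎ (∀ u v → u ≡ v)
    connected⇒join⊎trivial conn with kind σ in b≡
    ... | true  = inj₁ refl
    ... | false = inj₂ λ u v → trans (≡w u) (≡.sym (≡w v))
      where
        a = proj₁ (Split.left-nonempty σ)
        b = proj₁ (Split.right-nonempty σ)
        shared = walk-meets-both-parts b≡ (proj₂ (conn a b))
                   (proj₂ (Split.left-nonempty σ)) (proj₂ (Split.right-nonempty σ))
        w = proj₁ shared
        isolated : ∀ u → adj G w u ≡ false
        isolated u with covers-all u
        ... | inj₁ u∈ = adj-sym G (trans (Split.across σ u∈ (proj₂ (proj₂ shared))) b≡)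
        ... | inj₂ u∈ = trans (Split.across σ (proj₁ (proj₂ shared)) u∈) b≡
        ≡w : ∀ u → u ≡ w
        ≡w u with conn w u
        ... | _ , here = refl
        ... | _ , step wx _ = contradiction (isolated _) (not-¬ wx)

    join-across : kind σ ≡ true → ∀ {x y} → x ∈ left σ → y ∈ right σ → Adj G x y
    join-across join x∈ y∈ = trans (Split.across σ x∈ y∈) join

    join-bridges : kind σ ≡ true → ∀ {a b} → a ∈ left σ → b ∈ right σ → Bridges G a b
    join-bridges join {a} {b} a∈ b∈ {u} {w} _ uw with covers-all u | covers-all w
    ... | inj₁ u∈ | inj₁ w∈ = b , inj₂ refl , edge u∈ b∈ , adj-sym G (edge w∈ b∈)
      where edge = join-across join
    ... | inj₂ u∈ | inj₂ w∈ = a , inj₁ refl , adj-sym G (edge a∈ u∈) , edge a∈ w∈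
      where edge = join-across join
    ... | inj₁ u∈ | inj₂ w∈ = contradiction uw (not-¬ (join-across join u∈ w∈))
    ... | inj₂ u∈ | inj₁ w∈ = contradiction (adj-sym G uw) (not-¬ (join-across join w∈ u∈))

    connected⇒bridged⊎trivial : Connected G →
                                (∀ (u v : Fin n) → u ≡ v) ⊎ ∃₂ λ a b → a ≢ b × Bridges G a b
    connected⇒bridged⊎trivial conn with connected⇒join⊎trivial conn
    ... | inj₂ trivial = inj₁ trivial
    ... | inj₁ join =
      let a , a∈ = Split.left-nonempty σ
          b , b∈ = Split.right-nonempty σ
      in inj₂ (a , b , Adj⇒≢ G (join-across join a∈ b∈) , join-bridges join a∈ b∈)

connected-cograph⇒bridged⊎trivial : ∀ {n} (G : Graph n) → Connected G → IsCograph G →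
                              (∀ (u v : Fin n) → u ≡ v) ⊎ ∃₂ λ a b → a ≢ b × Bridges G a b
connected-cograph⇒bridged⊎trivial {zero}  G _    _       = inj₁ λ ()
connected-cograph⇒bridged⊎trivial {suc n} G conn cograph =
  connected⇒bridged⊎trivial G (cograph-split G cograph zero (tabulate suc)) conn

open import Data.Fin.Subset using (Subset; _∈_; _∉_; _⊆_; ∣_∣; ⊤; _-_; ∁; ⁅_⁆)
open import Data.Fin.Subset.Properties
  using (_∈?_; ∈⊤; ⊆⊤; ∣⊤∣≡n; p─⊥≡p; p─q⊆p; x∈p∧x≢y⇒x∈p-y; p⊆q⇒∣p∣≤∣q∣;
         x∈∁p⇒x∉p; x∉∁p⇒x∈p)

x∉p-x : ∀ {n} (p : Subset n) x → x ∉ p - x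
x∉p-x (_ ∷ _) zero    ()
x∉p-x (_ ∷ p) (suc x) (there x∈) = x∉p-x p x x∈

x∈p-y⇒x≢y : ∀ {n} {p : Subset n} {x y} → x ∈ p - y → x ≢ y
x∈p-y⇒x≢y {p = p} x∈ refl = x∉p-x p _ x∈

p⊆q∧x∉p⇒p⊆q-x : ∀ {n} {p q : Subset n} {x} → p ⊆ q → x ∉ p → p ⊆ q - x
p⊆q∧x∉p⇒p⊆q-x p⊆q x∉p y∈p = x∈p∧x≢y⇒x∈p-y (p⊆q y∈p) λ { refl → x∉p y∈p }

x∈p⇒suc∣p-x∣≡∣p∣ : ∀ {n} {p : Subset n} {x} → x ∈ p → suc ∣ p - x ∣ ≡ ∣ p ∣
x∈p⇒suc∣p-x∣≡∣p∣ {p = _ ∷ p}       here      = cong (suc ∘ ∣_∣) (p─⊥≡p p)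
x∈p⇒suc∣p-x∣≡∣p∣ {p = true ∷ _}  (there x∈) = cong suc (x∈p⇒suc∣p-x∣≡∣p∣ x∈)
x∈p⇒suc∣p-x∣≡∣p∣ {p = false ∷ _} (there x∈) = x∈p⇒suc∣p-x∣≡∣p∣ x∈

suc∣⊤-x∣≡n : ∀ {n} (x : Fin n) → suc ∣ ⊤ - x ∣ ≡ n
suc∣⊤-x∣≡n {n} x = trans (x∈p⇒suc∣p-x∣≡∣p∣ {p = ⊤} {x} ∈⊤) (∣⊤∣≡n n)

suc²∣⊤-x-y∣≡n : ∀ {n} {x y : Fin n} → x ≢ y → suc (suc ∣ ⊤ - x - y ∣) ≡ n
suc²∣⊤-x-y∣≡n {x = x} x≢y =
  trans (cong suc (x∈p⇒suc∣p-x∣≡∣p∣ (x∈p∧x≢y⇒x∈p-y ∈⊤ (≢-sym x≢y)))) (suc∣⊤-x∣≡n x)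

x∉p⇒∣p∣<n : ∀ {n} {p : Subset n} {x} → x ∉ p → ∣ p ∣ < n
x∉p⇒∣p∣<n {x = x} x∉p =
  ≤-trans (s≤s (p⊆q⇒∣p∣≤∣q∣ (p⊆q∧x∉p⇒p⊆q-x ⊆⊤ x∉p))) (≤-reflexive (suc∣⊤-x∣≡n x))

x,y∉p⇒suc²∣p∣≤n : ∀ {n} {p : Subset n} {x y} → x ≢ y → x ∉ p → y ∉ p → suc (suc ∣ p ∣) ≤ n
x,y∉p⇒suc²∣p∣≤n x≢y x∉p y∉p =
  ≤-trans (s≤s (s≤s (p⊆q⇒∣p∣≤∣q∣ (p⊆q∧x∉p⇒p⊆q-x (p⊆q∧x∉p⇒p⊆q-x ⊆⊤ x∉p) y∉p))))
          (≤-reflexive (suc²∣⊤-x-y∣≡n x≢y))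

module _ {n : ℕ} (G : Graph n) where

  visible-refl : ∀ X u → Visible G X u u
  visible-refl X u = 0 , here , (λ _ _ → z≤n) , []

  visible-adjacent : ∀ X {u v} → Adj G u v → Visible G X u v
  visible-adjacent X {u} {v} uv = 1 , step uv here , shortest , []
    where
      shortest : ∀ k → Walk G u v k → 1 ≤ k
      shortest zero    here = contradiction refl (Adj⇒≢ G uv)
      shortest (suc k) _    = s≤s z≤n

  visible-via : ∀ X {u v x} → u ≢ v → adj G u v ≡ false → Adj G u x → Adj G x v → x ∉ X →
                Visible G X u v
  visible-via X {u} {v} u≢v uv ux xv x∉X = 2 , step ux (step xv here) , shortest , x∉X ∷ []
    where
      shortest : ∀ k → Walk G u v k → 2 ≤ k
      shortest zero          here            = contradiction refl u≢v
      shortest (suc zero)    (step uv′ here) = contradiction uv (not-¬ uv′)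
      shortest (suc (suc k)) _               = s≤s (s≤s z≤n)

  visible-if-bridged : ∀ X u v →
    (u ≢ v → adj G u v ≡ false → ∃ λ x → Adj G u x × Adj G x v × x ∉ X) → Visible G X u v
  visible-if-bridged X u v bridge with u ≟ v | adj G u v ≟ᵇ true
  ... | yes refl | _      = visible-refl X u
  ... | no _     | yes uv = visible-adjacent X uv
  ... | no u≢v   | no ¬uv =
    let x , ux , xv , x∉X = bridge u≢v (¬-not ¬uv) in visible-via X u≢v (¬-not ¬uv) ux xv x∉X

  -- On a path between non-adjacent vertices the vertex after u is internal.
  visible-exit : ∀ {X u v} → u ≢ v → adj G u v ≡ false → Visible G X u v →
                 ∃ λ x → Adj G u x × x ∉ X
  visible-exit u≢v _  (_ , here , _) = contradiction refl u≢v
  visible-exit _   uv (_ , step uv′ here , _) = contradiction uv (not-¬ uv′)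
  visible-exit _   _  (_ , step {w = x} ux (step _ _) , _ , x∉X ∷ _) = x , ux , x∉X

  bridges⇒total : ∀ {a b} → Bridges G a b → IsTotalMutualVisibilitySet G (⊤ - a - b)
  bridges⇒total {a} {b} bridges u w = visible-if-bridged _ u w λ u≢w uw →
    let x , x∈ab , ux , xw = bridges u≢w uw in x , ux , xw , outside x∈ab
    where
      outside : ∀ {x} → x ≡ a ⊎ x ≡ b → x ∉ ⊤ - a - b
      outside (inj₁ refl) a∈ = x∉p-x ⊤ a (p─q⊆p (⊤ - a) ⁅ b ⁆ a∈)
      outside (inj₂ refl)    = x∉p-x (⊤ - a) b

  connected-cograph⇒large-total : Connected G → IsCograph G →
    ∃ λ Y → IsTotalMutualVisibilitySet G Y × n ≤ suc (suc ∣ Y ∣)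
  connected-cograph⇒large-total conn cograph
    with connected-cograph⇒bridged⊎trivial G conn cograph
  ... | inj₁ trivial =
    ⊤ , (λ u w → visible-if-bridged ⊤ u w λ u≢w _ → contradiction (trivial u w) u≢w) ,
    ≤-trans (≤-reflexive (≡.sym (∣⊤∣≡n n))) (m≤n+m _ 2)
  ... | inj₂ (a , b , a≢b , bridges) =
    ⊤ - a - b , bridges⇒total bridges , ≤-reflexive (≡.sym (suc²∣⊤-x-y∣≡n a≢b))

  universal⇒total : ∀ {u} → IsUniversal G u → IsTotalMutualVisibilitySet G (⊤ - u)
  universal⇒total {u} univ x w = visible-if-bridged _ x w λ x≢w xw →
    u , adj-sym G (univ x (≢u x≢w xw)) , univ w (≢u (≢-sym x≢w) (adj-sym G xw)) , x∉p-x ⊤ u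
    where
      ≢u : ∀ {x w} → x ≢ w → adj G x w ≡ false → x ≢ u
      ≢u x≢w xw refl = not-¬ (univ _ (≢-sym x≢w)) xw

  IsBigMu⇒mutual-visibility : (β : IsBigMu G) → IsMutualVisibilitySet G (⊤ - proj₁ β)
  IsBigMu⇒mutual-visibility (v , T , _ , clique , _ , join) u w u∈ w∈ =
    visible-if-bridged _ u w λ u≢w uw →
      v , adj-sym G (proj₁ (join u u≢v (∉T w≢v u≢w uw))) ,
          proj₁ (join w w≢v (∉T u≢v (≢-sym u≢w) (adj-sym G uw))) , x∉p-x ⊤ v
    where
      u≢v = x∈p-y⇒x≢y u∈
      w≢v = x∈p-y⇒x≢y w∈
      ∉T : ∀ {x y} → y ≢ v → x ≢ y → adj G x y ≡ false → x ∉ T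
      ∉T {x} {y} y≢v x≢y xy x∈T with y ∈? T
      ... | yes y∈T = not-¬ (clique x y x∈T y∈T x≢y) xy
      ... | no  y∉T = not-¬ (proj₂ (join y y≢v y∉T) x x∈T) xy

  -- Every vertex but z lies in X, so a shortest path between non-adjacent
  -- vertices other than z can only pass through z: they are both adjacent to
  -- z, and the non-neighbours of z form a clique completely joined to the rest.
  mutual-visibility-all-but⇒IsBigMu : ∀ {X z} → IsMutualVisibilitySet G X →
                                      (∀ y → y ≢ z → y ∈ X) → IsBigMu G
  mutual-visibility-all-but⇒IsBigMu {X} {z} mvX X⊇ =
    z , T , x∉p-x (∁ N) z , clique , T-nonadj , join
    where
      via-z : ∀ {u w} → u ≢ w → u ≢ z → w ≢ z → adj G u w ≡ false → Adj G u z
      via-z u≢w u≢z w≢z uw with visible-exit u≢w uw (mvX _ _ (X⊇ _ u≢z) (X⊇ _ w≢z))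
      ... | x , ux , x∉X with x ≟ z
      ...   | yes refl = ux
      ...   | no  x≢z  = contradiction (X⊇ x x≢z) x∉X

      N T : Subset n
      N = Vec.tabulate (adj G z)
      T = ∁ N - z

      Adj⇒∈N : ∀ {x} → Adj G z x → x ∈ N
      Adj⇒∈N {x} zx = lookup⇒[]= x N (trans (lookup∘tabulate (adj G z) x) zx)

      ∈N⇒Adj : ∀ {x} → x ∈ N → Adj G z x
      ∈N⇒Adj {x} x∈N = trans (≡.sym (lookup∘tabulate (adj G z) x)) ([]=⇒lookup x∈N)

      T-nonadj : ∀ a → a ∈ T → ¬ Adj G z a
      T-nonadj a a∈T za = x∈∁p⇒x∉p (p─q⊆p (∁ N) ⁅ z ⁆ a∈T) (Adj⇒∈N za)

      T-adj : ∀ {a h} → a ∈ T → a ≢ h → h ≢ z → Adj G a h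
      T-adj a∈T a≢h h≢z = ¬-not λ ah →
        T-nonadj _ a∈T (adj-sym G (via-z a≢h (x∈p-y⇒x≢y a∈T) h≢z ah))

      clique : ∀ a b → a ∈ T → b ∈ T → a ≢ b → Adj G a b
      clique a b a∈T b∈T a≢b = T-adj a∈T a≢b (x∈p-y⇒x≢y b∈T)

      join : ∀ h → h ≢ z → h ∉ T → Adj G z h × (∀ a → a ∈ T → Adj G a h)
      join h h≢z h∉T =
        ∈N⇒Adj (x∉∁p⇒x∈p λ h∈∁N → h∉T (x∈p∧x≢y⇒x∈p-y h∈∁N h≢z)) ,
        λ a a∈T → T-adj a∈T (λ { refl → h∉T a∈T }) h≢z

  non-universal⇒non-neighbour : ∀ {w} → ¬ IsUniversal G w → ∃ λ u → u ≢ w × adj G w u ≡ false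
  non-universal⇒non-neighbour {w} ¬univ
    with Fin.any? (λ u → ¬? (u ≟ w) ×-dec (adj G w u ≟ᵇ false))
  ... | yes found = found
  ... | no  none  = contradiction (λ u u≢w → ¬-not λ wu → none (u , u≢w , wu)) ¬univ

  total⇒outside-neighbour : ∀ {Y w} → IsTotalMutualVisibilitySet G Y → ¬ IsUniversal G w →
                            ∃ λ x → Adj G w x × x ∉ Y
  total⇒outside-neighbour {w = w} totY ¬univ =
    let u , u≢w , wu = non-universal⇒non-neighbour ¬univ
    in visible-exit (≢-sym u≢w) wu (totY w u)

  -- Y misses a neighbour x of any vertex, and then a neighbour of x.
  no-universal⇒total-small : ¬ ∃ (IsUniversal G) → Fin n → ∀ {Y} →
                             IsTotalMutualVisibilitySet G Y → suc (suc ∣ Y ∣) ≤ n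
  no-universal⇒total-small ¬univ v totY =
    let x , _  , x∉Y = total⇒outside-neighbour totY (¬univ ∘ (v ,_))
        y , xy , y∉Y = total⇒outside-neighbour totY (¬univ ∘ (x ,_))
    in x,y∉p⇒suc²∣p∣≤n (Adj⇒≢ G xy) x∉Y y∉Y

  μt<μ⇒bigμ-without-universal : Connected G → IsCograph G → ∀ {m t} →
    IsMu G m → IsMuT G t → t < m → IsBigMu G × ¬ ∃ (IsUniversal G)
  μt<μ⇒bigμ-without-universal conn cograph {m} {t} ((X , mvX , ∣X∣≡m) , _) (_ , maxT) t<m =
    mutual-visibility-all-but⇒IsBigMu mvX X⊇ , no-universal
    where
      total<∣X∣ : ∀ {Y} → IsTotalMutualVisibilitySet G Y → ∣ Y ∣ < ∣ X ∣
      total<∣X∣ totY = ≤-<-trans (maxT _ totY) (≡.subst (t <_) (≡.sym ∣X∣≡m) t<m)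

      n≤suc∣X∣ : n ≤ suc ∣ X ∣
      n≤suc∣X∣ = let _ , totY , n≤ = connected-cograph⇒large-total conn cograph
                 in ≤-trans n≤ (s≤s (total<∣X∣ totY))

      missed : ∃ λ z → z ∉ X
      missed = Fin.¬∀⟶∃¬ n (_∈ X) (_∈? X) λ all →
        <-irrefl refl (total<∣X∣ λ u w → mvX u w (all u) (all w))
      z = proj₁ missed

      X⊇ : ∀ y → y ≢ z → y ∈ X
      X⊇ y y≢z with y ∈? X
      ... | yes y∈X = y∈X
      ... | no  y∉X = contradiction (≤-trans (x,y∉p⇒suc²∣p∣≤n y≢z y∉X (proj₂ missed)) n≤suc∣X∣)
                                    (<-irrefl refl)

      no-universal : ¬ ∃ (IsUniversal G)
      no-universal (u , univ) = <-irrefl refl (<-≤-trans (total<∣X∣ (universal⇒total univ)) ∣X∣≤)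
        where
          ∣X∣≤ : ∣ X ∣ ≤ ∣ ⊤ - u ∣
          ∣X∣≤ = s≤s⁻¹ (≤-trans (x∉p⇒∣p∣<n (proj₂ missed)) (≤-reflexive (≡.sym (suc∣⊤-x∣≡n u))))

  bigμ-without-universal⇒μt<μ : ∀ {m t} → IsMu G m → IsMuT G t →
    IsBigMu G × ¬ ∃ (IsUniversal G) → t < m
  bigμ-without-universal⇒μt<μ {m} {t} (_ , maxM) ((Y , totY , ∣Y∣≡t) , _) (β@(v , _) , ¬univ) =
    s≤s⁻¹ (begin
      suc (suc t)       ≡⟨ cong (2 +_) (≡.sym ∣Y∣≡t) ⟩
      suc (suc ∣ Y ∣)   ≤⟨ no-universal⇒total-small ¬univ v totY ⟩
      n                 ≡⟨ ≡.sym (suc∣⊤-x∣≡n v) ⟩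
      suc ∣ ⊤ - v ∣     ≤⟨ s≤s (maxM _ (IsBigMu⇒mutual-visibility β)) ⟩
      suc m             ∎)
    where open ≤-Reasoning

corollary4p6 : ∀ {n : ℕ} (G : Graph n) → Connected G → IsCograph G →
    ∀ (m t : ℕ) → IsMu G m → IsMuT G t →
    (t < m) ⇔ (IsBigMu G × ¬ (∃ λ (v : Fin n) → IsUniversal G v))
corollary4p6 G conn cograph m t μ μt =
  mk⇔ (μt<μ⇒bigμ-without-universal G conn cograph μ μt) (bigμ-without-universal⇒μt<μ G μ μt)
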